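{- For every base $\mathcal{B}$, atomic multiset $L$, finite multiset $\Gamma$ of formulae and formula $\varphi$: $\Gamma\Vdash^{L}_{\mathcal{B}}\varphi$ if and only if for every base $\mathcal{C}\supseteq\mathcal{B}$ and every atomic multiset $K$, $\Vdash^{K}_{\mathcal{C}}\Gamma$ implies $\Vdash^{L\uplus K}_{\mathcal{C}}\varphi$.
   Context: Fix a set $\mathbb{A}$ of propositional atoms. All multisets are finite; $\uplus$ denotes multiset union; an atomic multiset is a finite multiset of atoms. Formulae: $\varphi ::= p\in\mathbb{A}\mid\top\mid 0\mid 1\mid\varphi\multimap\varphi\mid\varphi\otimes\varphi\mid\varphi\mathbin{\&}\varphi\mid\varphi\oplus\varphi\mid\,!\varphi$. Bases. An atomic sequent is a pair $P\Rightarrow p$ ($P$ atomic multiset, $p$ atom); an atomic box is a finite multiset of atomic sequents; an atomic rule is a triple $\langle\mathbf{A},\mathbf{S},p\rangle$ with $\mathbf{A}$ a finite multiset of atomic boxes, $\mathbf{S}$ an atomic box, $p$ an atom. A base is a set of atomic rules; $\mathcal{C}\supseteq\mathcal{B}$ is set inclusion. An atom $p$ is persistent in $\mathcal{B}$ if $\mathcal{B}$ contains a rule $\langle\varnothing,\mathbf{S},p\rangle$ with $\mathbf{S}\neq\varnothing$. Derivability $P\vdash_{\mathcal{B}}p$ is the smallest relation closed under: (Ref) $\{p\}\vdash_{\mathcal{B}}p$; (App) if $\langle\mathbf{A},\mathbf{S},p\rangle\in\mathcal{B}$ with $\mathbf{A}=\{\mathbf{T}_1,\dots,\mathbf{T}_m\}$,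 and there are $n\ge m$, atomic multisets $C_1,\dots,C_n$ and a multiset $D=\{d_{m+1},\dots,d_n\}$ of atoms persistent in $\mathcal{B}$ with $C_i\uplus Q\vdash_{\mathcal{B}}q$ for all $i\le m$ and $Q\Rightarrow q\in\mathbf{T}_i$, $C_j\vdash_{\mathcal{B}}d_j$ for all $m<j\le n$, and $D\uplus U\vdash_{\mathcal{B}}v$ for all $U\Rightarrow v\in\mathbf{S}$, then $C_1\uplus\dots\uplus C_n\vdash_{\mathcal{B}}p$. Support. For a base $\mathcal{B}$, atomic multiset $L$: (At) $\Vdash^L_{\mathcal{B}}p$ iff $L\vdash_{\mathcal{B}}p$; ($\multimap$) $\Vdash^L_{\mathcal{B}}\varphi\multimap\psi$ iff $\varphi\Vdash^L_{\mathcal{B}}\psi$; ($\otimes$) $\Vdash^L_{\mathcal{B}}\varphi\otimes\psi$ iff for all $\mathcal{C}\supseteq\mathcal{B}$, atomic multisets $K$, atoms $p$: if $\{\varphi,\psi\}\Vdash^K_{\mathcal{C}}p$ then $\Vdash^{L\uplus K}_{\mathcal{C}}p$; ($1$) $\Vdash^L_{\mathcal{B}}1$ iff for all $\mathcal{C}\supseteq\mathcal{B}$, $K$, $p$: if $\Vdash^K_{\mathcal{C}}p$ then $\Vdash^{L\uplus K}_{\mathcal{C}}p$; ($\mathbin{\&}$) $\Vdash^L_{\mathcal{B}}\varphi\mathbin{\&}\psi$ iff $\Vdash^L_{\mathcal{B}}\varphi$ and $\Vdash^L_{\mathcal{B}}\psi$; ($\oplus$) $\Vdash^L_{\mathcal{B}}\varphi\oplus\psi$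 iff for all $\mathcal{C}\supseteq\mathcal{B}$, $K$, $p$: if $\varphi\Vdash^K_{\mathcal{C}}p$ and $\psi\Vdash^K_{\mathcal{C}}p$ then $\Vdash^{L\uplus K}_{\mathcal{C}}p$; ($0$) $\Vdash^L_{\mathcal{B}}0$ iff $\Vdash^{L\uplus K}_{\mathcal{B}}p$ for all atoms $p$ and atomic multisets $K$; ($\top$) $\Vdash^L_{\mathcal{B}}\top$ always; ($!$) $\Vdash^L_{\mathcal{B}}\,!\varphi$ iff for all $\mathcal{C}\supseteq\mathcal{B}$, $K$, $p$: if (for all $\mathcal{D}\supseteq\mathcal{C}$, $\Vdash^{\varnothing}_{\mathcal{D}}\varphi$ implies $\Vdash^K_{\mathcal{D}}p$) then $\Vdash^{L\uplus K}_{\mathcal{C}}p$. Multisets: $\Vdash^L_{\mathcal{B}}\varnothing$ iff $L=\varnothing$; $\Vdash^L_{\mathcal{B}}\{\varphi\}$ iff $\Vdash^L_{\mathcal{B}}\varphi$; $\Vdash^L_{\mathcal{B}}\Gamma\uplus\Delta$ iff $L=K\uplus M$ for some $K,M$ with $\Vdash^K_{\mathcal{B}}\Gamma$, $\Vdash^M_{\mathcal{B}}\Delta$. (Inf) For non-empty $\Gamma$, write $\Gamma=\,!\Delta\uplus\Theta$ with $!\Delta$ the elements whose top-level connective is $!$ and $\Theta$ the rest; $\Gamma\Vdash^L_{\mathcal{B}}\varphi$ iff for all $\mathcal{C}\supseteq\mathcal{B}$ and atomic $K$: if $\Vdash^{\varnothing}_{\mathcal{C}}\delta$ for every $\delta\in\Delta$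 and $\Vdash^K_{\mathcal{C}}\Theta$, then $\Vdash^{L\uplus K}_{\mathcal{C}}\varphi$. For $\Gamma=\varnothing$, $\Gamma\Vdash^L_{\mathcal{B}}\varphi$ means $\Vdash^L_{\mathcal{B}}\varphi$. -}

module Defs where

open import Level using (Lift; lift)
import Level
open import Data.Unit using () renaming (⊤ to Unit)
open import Data.Empty using (⊥)
open import Data.Product using (Σ; ∃; ∃-syntax; _×_; _,_; proj₁; proj₂)
open import Data.List using (List; []; _∷_; _++_; concat; map)
open import Data.List.Membership.Propositional using (_∈_)
open import Data.List.Relation.Unary.All using (All)
open import Data.List.Relation.Binary.Pointwise using (Pointwise)
open import Data.List.Relation.Binary.Permutation.Propositional using (_↭_)
open import Relation.Binary.PropositionalEquality using (_≡_)
open import Relation.Nullary using (¬_)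

-- Conventions: atoms form an arbitrary type Atom; finite multisets are
-- represented by lists, multiset equality is permutation _↭_ and
-- multiset union is _++_.  Every relation below on multisets is
-- invariant under permutation of its multiset arguments by construction.

infixr 30 _⊸_
infixr 35 _⊗_ _&_ _⊕_
infix 40 !_

data Formula (Atom : Set) : Set where
  atom : Atom → Formula Atom
  ⊤f   : Formula Atom
  𝟘    : Formula Atom
  𝟙    : Formula Atom
  _⊸_  : Formula Atom → Formula Atom → Formula Atom
  _⊗_  : Formula Atom → Formula Atom → Formula Atom
  _&_  : Formula Atom → Formula Atom → Formula Atom
  _⊕_  : Formula Atom → Formula Atom → Formula Atom
  !_   : Formula Atom → Formula Atom

module _ {Atom : Set} where

  Sequent : Set
  Sequent = List Atom × Atom

  Box : Set
  Box = List Sequent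

  record Rule : Set where
    constructor ⟨_,_,_⟩
    field
      prems : List Box
      disch : Box
      concl : Atom

  Base : Set₁
  Base = Rule → Set

  _⊆B_ : Base → Base → Set
  B ⊆B C = ∀ r → B r → C r

  Persistent : Base → Atom → Set
  Persistent B p = Σ Box λ S → ¬ (S ≡ []) × B ⟨ [] , S , p ⟩

  data Der (B : Base) : List Atom → Atom → Set where
    ref : ∀ {L p} → L ↭ (p ∷ []) → Der B L p
    app : ∀ {A S p L}
        → B ⟨ A , S , p ⟩
        → (Cs : List (List Atom))
        → Pointwise (λ T C → ∀ {Q q} → (Q , q) ∈ T → Der B (C ++ Q) q) A Cs
        → (Es : List (List Atom × Atom))      -- pairs (C_j , d_j), m < j ≤ n
        → All (λ e → Persistent B (proj₂ e) × Der B (proj₁ e) (proj₂ e)) Es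
        → (∀ {U v} → (U , v) ∈ S → Der B (map proj₂ Es ++ U) v)
        → L ↭ (concat Cs ++ concat (map proj₁ Es))
        → Der B L p

  -- Generic multiset support and inference, parametrised by the support
  -- predicates of the members (needed to make the mutual recursion of
  -- support structurally terminating).

  SuppPred : Set₂
  SuppPred = Base → List Atom → Set₁

  MS : List SuppPred → Base → List Atom → Set₁
  MS []            B L = Lift (Level.suc Level.zero) (L ↭ [])
  MS (P ∷ [])      B L = P B L
  MS (P ∷ Q ∷ Ps)  B L =
    ∃[ K ] ∃[ M ] (Lift (Level.suc Level.zero) (L ↭ (K ++ M)) × P B K × MS (Q ∷ Ps) B M)

  -- a member of the antecedent of an inference: either !δ (bang, with the
  -- predicate  D ↦ ⊩^∅_D δ ) or a non-! formula (lin, with its support)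
  data Entry : Set₂ where
    bang : (Base → Set₁) → Entry
    lin  : SuppPred → Entry

  Bangs : List Entry → Base → Set₁
  Bangs []             C = Lift (Level.suc Level.zero) Unit
  Bangs (bang P ∷ es)  C = P C × Bangs es C
  Bangs (lin _ ∷ es)   C = Bangs es C

  Lins : List Entry → List SuppPred
  Lins []            = []
  Lins (bang _ ∷ es) = Lins es
  Lins (lin P ∷ es)  = P ∷ Lins es

  -- clause (Inf) for a non-empty antecedent
  InfG : List Entry → SuppPred → Base → List Atom → Set₁
  InfG es T B L = ∀ C → B ⊆B C → ∀ K → Bangs es C → MS (Lins es) C K → T C (L ++ K)

  mutual
    entry : Formula Atom → Entry
    entry (! δ) = bang (λ D → supp D [] δ)
    entry φ     = lin (λ D M → supp D M φ)

    supp : Base → List Atom → Formula Atom → Set₁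
    supp B L (atom p) = Lift (Level.suc Level.zero) (Der B L p)
    supp B L (φ ⊸ ψ)  = InfG (entry φ ∷ []) (λ C M → supp C M ψ) B L
    supp B L (φ ⊗ ψ)  = ∀ C → B ⊆B C → ∀ K p
      → InfG (entry φ ∷ entry ψ ∷ []) (λ D M → supp D M (atom p)) C K
      → supp C (L ++ K) (atom p)
    supp B L 𝟙        = ∀ C → B ⊆B C → ∀ K p
      → supp C K (atom p) → supp C (L ++ K) (atom p)
    supp B L (φ & ψ)  = supp B L φ × supp B L ψ
    supp B L (φ ⊕ ψ)  = ∀ C → B ⊆B C → ∀ K p
      → InfG (entry φ ∷ []) (λ D M → supp D M (atom p)) C K
      → InfG (entry ψ ∷ []) (λ D M → supp D M (atom p)) C K
      → supp C (L ++ K) (atom p)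
    supp B L 𝟘        = ∀ p K → supp B (L ++ K) (atom p)
    supp B L ⊤f       = Lift (Level.suc Level.zero) Unit
    supp B L (! φ)    = ∀ C → B ⊆B C → ∀ K p
      → (∀ D → C ⊆B D → supp D [] φ → supp D K (atom p))
      → supp C (L ++ K) (atom p)

  suppMS : Base → List Atom → List (Formula Atom) → Set₁
  suppMS B L Γ = MS (map (λ φ D M → supp D M φ) Γ) B L

  _⊩[_,_]_ : List (Formula Atom) → Base → List Atom → Formula Atom → Set₁
  [] ⊩[ B , L ] φ = supp B L φ
  (γ ∷ Γ) ⊩[ B , L ] φ = InfG (map entry (γ ∷ Γ)) (λ C M → supp C M φ) B L

{-# OPTIONS --safe #-}
module Submission where

-- The right-hand side differs from clause (Inf) only in the treatment of the !-formulae of Γ: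
-- (Inf) assumes ⊩^∅ δ for each !δ ∈ Γ, whereas ⊩^K Γ lets an arbitrary share of K support !δ.
-- From ⊩^∅ δ one gets ⊩^∅ !δ, which costs no resources. Conversely, the clause for ! only
-- eliminates ⊩^L !δ into atoms, but an induction on the conclusion extends it to every formula;
-- this turns a share supporting !δ into the hypothesis ⊩^∅ δ that (Inf) needs.

open import Defs
open import Data.List using (List; []; _∷_; _++_; map)
open import Function.Bundles using (_⇔_; mk⇔)
open import Level using (lift)
open import Data.Unit using (tt)
open import Data.Product using (∃-syntax; _×_; _,_; proj₁; proj₂)
open import Data.List.Relation.Unary.All using (All; []; _∷_)
open import Data.List.Membership.Propositional using (_∈_)
open import Data.List.Relation.Binary.Pointwise using (Pointwise; []; _∷_)
open import Data.List.Relation.Binary.Permutation.Propositional using (_↭_; ↭-refl; ↭-sym; ↭-trans)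
open import Data.List.Relation.Binary.Permutation.Propositional.Properties
  using (++⁺ˡ; ++⁺ʳ; ++-identityʳ; ++-assoc; shifts)

module _ {Atom : Set} where

  private
    variable
      B C D : Base {Atom}
      K L M : List Atom
      p : Atom
      Γ : List (Formula Atom)
      es : List Entry

  ⊆B-refl : B ⊆B B
  ⊆B-refl _ r = r

  ⊆B-trans : B ⊆B C → C ⊆B D → B ⊆B D
  ⊆B-trans B⊆C C⊆D r x = C⊆D r (B⊆C r x)

  Persistent-mono : B ⊆B C → Persistent B p → Persistent C p
  Persistent-mono B⊆C (S , S≢[] , r) = S , S≢[] , B⊆C _ r

  mutual
    Der-mono : B ⊆B C → Der B L p → Der C L p
    Der-mono B⊆C (ref σ) = ref σ
    Der-mono B⊆C (app r Cs prems Es persistents disch σ) =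
      app (B⊆C _ r) Cs (premises-mono B⊆C prems) Es (persistents-mono B⊆C persistents)
          (λ U⇒v → Der-mono B⊆C (disch U⇒v)) σ

    premises-mono : ∀ {A Cs} → B ⊆B C
      → Pointwise (λ T Cᵢ → ∀ {Q q} → (Q , q) ∈ T → Der B (Cᵢ ++ Q) q) A Cs
      → Pointwise (λ T Cᵢ → ∀ {Q q} → (Q , q) ∈ T → Der C (Cᵢ ++ Q) q) A Cs
    premises-mono B⊆C [] = []
    premises-mono B⊆C (ders ∷ prems) =
      (λ Q⇒q → Der-mono B⊆C (ders Q⇒q)) ∷ premises-mono B⊆C prems

    persistents-mono : ∀ {Es : List (List Atom × Atom)} → B ⊆B C
      → All (λ e → Persistent B (proj₂ e) × Der B (proj₁ e) (proj₂ e)) Es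
      → All (λ e → Persistent C (proj₂ e) × Der C (proj₁ e) (proj₂ e)) Es
    persistents-mono B⊆C [] = []
    persistents-mono B⊆C ((pers , der) ∷ rest) =
      (Persistent-mono B⊆C pers , Der-mono B⊆C der) ∷ persistents-mono B⊆C rest

  Der-resp-↭ : L ↭ M → Der B L p → Der B M p
  Der-resp-↭ τ (ref σ) = ref (↭-trans (↭-sym τ) σ)
  Der-resp-↭ τ (app r Cs prems Es persistents disch σ) =
    app r Cs prems Es persistents disch (↭-trans (↭-sym τ) σ)

  supportOf : Formula Atom → SuppPred {Atom}
  supportOf φ B L = supp B L φ

  Resp-↭ : SuppPred {Atom} → Set₁
  Resp-↭ P = ∀ {B K L} → K ↭ L → P B K → P B L

  supp-resp-↭ : ∀ φ → K ↭ L → supp B K φ → supp B L φ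
  supp-resp-↭ (atom p) τ (lift d) = lift (Der-resp-↭ τ d)
  supp-resp-↭ ⊤f      τ x = x
  supp-resp-↭ 𝟘       τ x = λ p K → supp-resp-↭ (atom p) (++⁺ʳ K τ) (x p K)
  supp-resp-↭ 𝟙       τ x = λ C s K p y → supp-resp-↭ (atom p) (++⁺ʳ K τ) (x C s K p y)
  supp-resp-↭ (φ ⊸ ψ) τ x = λ C s K bs ms → supp-resp-↭ ψ (++⁺ʳ K τ) (x C s K bs ms)
  supp-resp-↭ (φ ⊗ ψ) τ x = λ C s K p y → supp-resp-↭ (atom p) (++⁺ʳ K τ) (x C s K p y)
  supp-resp-↭ (φ & ψ) τ (x , y) = supp-resp-↭ φ τ x , supp-resp-↭ ψ τ y
  supp-resp-↭ (φ ⊕ ψ) τ x = λ C s K p y z → supp-resp-↭ (atom p) (++⁺ʳ K τ) (x C s K p y z)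
  supp-resp-↭ (! φ)   τ x = λ C s K p y → supp-resp-↭ (atom p) (++⁺ʳ K τ) (x C s K p y)

  supp-reassoc : ∀ φ L K M → supp B (L ++ (K ++ M)) φ → supp B ((L ++ K) ++ M) φ
  supp-reassoc φ L K M = supp-resp-↭ φ (↭-sym (++-assoc L K M))

  everyExtension-mono : ∀ {ℓ} {X : Base → Set ℓ}
    → (∀ C → B ⊆B C → X C) → B ⊆B C → (∀ D → C ⊆B D → X D)
  everyExtension-mono x B⊆C D C⊆D = x D (⊆B-trans B⊆C C⊆D)

  supp-mono : ∀ φ → supp B L φ → B ⊆B C → supp C L φ
  supp-mono (atom p) (lift d) B⊆C = lift (Der-mono B⊆C d)
  supp-mono ⊤f      x B⊆C = x
  supp-mono 𝟘       x B⊆C = λ p K → supp-mono (atom p) (x p K) B⊆C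
  supp-mono 𝟙       x B⊆C = everyExtension-mono x B⊆C
  supp-mono (φ ⊸ ψ) x B⊆C = everyExtension-mono x B⊆C
  supp-mono (φ ⊗ ψ) x B⊆C = everyExtension-mono x B⊆C
  supp-mono (φ & ψ) (x , y) B⊆C = supp-mono φ x B⊆C , supp-mono ψ y B⊆C
  supp-mono (φ ⊕ ψ) x B⊆C = everyExtension-mono x B⊆C
  supp-mono (! φ)   x B⊆C = everyExtension-mono x B⊆C

  MS-cons⁻ : ∀ (P : SuppPred {Atom}) Ps
    → MS (P ∷ Ps) B L → ∃[ K ] ∃[ M ] (L ↭ K ++ M × P B K × MS Ps B M)
  MS-cons⁻ {L = L} P []      x = L , [] , ↭-sym (++-identityʳ L) , x , lift ↭-refl
  MS-cons⁻ P (_ ∷ _) (K , M , lift σ , x , m) = K , M , σ , x , m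

  MS-cons⁺ : ∀ (P : SuppPred {Atom}) Ps
    → Resp-↭ P → L ↭ K ++ M → P B K → MS Ps B M → MS (P ∷ Ps) B L
  MS-cons⁺ {K = K} P []      resp σ x (lift M↭[]) =
    resp (↭-sym (↭-trans σ (↭-trans (++⁺ˡ K M↭[]) (++-identityʳ K)))) x
  MS-cons⁺ P (_ ∷ _) resp σ x m = _ , _ , lift σ , x , m

  suppMS-mono : ∀ Γ → suppMS C K Γ → C ⊆B D → suppMS D K Γ
  suppMS-mono [] m C⊆D = m
  suppMS-mono (γ ∷ Γ) m C⊆D with MS-cons⁻ (supportOf γ) (map supportOf Γ) m
  ... | K₁ , K₂ , σ , x , m′ =
    MS-cons⁺ (supportOf γ) (map supportOf Γ) (supp-resp-↭ γ) σ
      (supp-mono γ x C⊆D) (suppMS-mono Γ m′ C⊆D)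

  -- Lemmas about the antecedent of (Inf) recurse on this view instead of splitting on the
  -- nine formula constructors that `entry` is defined by.
  data EntryOf : Formula Atom → Entry → Set₂ where
    bangEntry : ∀ δ → EntryOf (! δ) (bang (λ D → supp D [] δ))
    linEntry  : ∀ γ → EntryOf γ (lin (supportOf γ))

  entryOf : ∀ γ → EntryOf γ (entry γ)
  entryOf (atom p) = linEntry (atom p)
  entryOf ⊤f       = linEntry ⊤f
  entryOf 𝟘        = linEntry 𝟘
  entryOf 𝟙        = linEntry 𝟙
  entryOf (φ ⊸ ψ)  = linEntry (φ ⊸ ψ)
  entryOf (φ ⊗ ψ)  = linEntry (φ ⊗ ψ)
  entryOf (φ & ψ)  = linEntry (φ & ψ)
  entryOf (φ ⊕ ψ)  = linEntry (φ ⊕ ψ)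
  entryOf (! δ)    = bangEntry δ

  entries : ∀ Γ → Pointwise EntryOf Γ (map entry Γ)
  entries []      = []
  entries (γ ∷ Γ) = entryOf γ ∷ entries Γ

  Bangs-mono : Pointwise EntryOf Γ es → Bangs es C → C ⊆B D → Bangs es D
  Bangs-mono [] bs C⊆D = bs
  Bangs-mono (bangEntry δ ∷ v) (x , bs) C⊆D = supp-mono δ x C⊆D , Bangs-mono v bs C⊆D
  Bangs-mono (linEntry _ ∷ v) bs C⊆D = Bangs-mono v bs C⊆D

  Lins-mono : Pointwise EntryOf Γ es → MS (Lins es) C K → C ⊆B D → MS (Lins es) D K
  Lins-mono [] m C⊆D = m
  Lins-mono (bangEntry _ ∷ v) m C⊆D = Lins-mono v m C⊆D
  Lins-mono {es = _ ∷ es} (linEntry γ ∷ v) m C⊆D with MS-cons⁻ (supportOf γ) (Lins es) m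
  ... | K₁ , K₂ , σ , x , m′ =
    MS-cons⁺ (supportOf γ) (Lins es) (supp-resp-↭ γ) σ
      (supp-mono γ x C⊆D) (Lins-mono v m′ C⊆D)

  !-intro : ∀ δ → supp C [] δ → supp C [] (! δ)
  !-intro δ x D C⊆D K p k = k D ⊆B-refl (supp-mono δ x C⊆D)

  !-elim : ∀ φ χ → supp B L (! φ)
    → (∀ C → B ⊆B C → supp C [] φ → supp C K χ) → supp B (L ++ K) χ
  !-elim φ (atom p) h k = h _ ⊆B-refl _ p k
  !-elim φ ⊤f       h k = lift tt
  !-elim φ (a & b)  h k =
    !-elim φ a h (λ C s y → proj₁ (k C s y)) , !-elim φ b h (λ C s y → proj₂ (k C s y))
  !-elim {L = L} {K = K} φ 𝟘 h k = λ p K′ →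
    supp-reassoc (atom p) L K K′ (h _ ⊆B-refl (K ++ K′) p λ C s y → k C s y p K′)
  !-elim {L = L} {K = K} φ 𝟙 h k = λ C s K′ p x →
    supp-reassoc (atom p) L K K′ (h C s (K ++ K′) p λ D s′ y →
      k D (⊆B-trans s s′) y D ⊆B-refl K′ p (supp-mono (atom p) x s′))
  !-elim {L = L} {K = K} φ (a ⊸ b) h k = λ C s K′ bs ms →
    supp-reassoc b L K K′ (!-elim φ b (supp-mono (! φ) h s) λ D s′ y →
      k D (⊆B-trans s s′) y D ⊆B-refl K′
        (Bangs-mono (entries (a ∷ [])) bs s′) (Lins-mono (entries (a ∷ [])) ms s′))
  !-elim {L = L} {K = K} φ (a ⊗ b) h k = λ C s K′ p x →
    supp-reassoc (atom p) L K K′ (h C s (K ++ K′) p λ D s′ y →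
      k D (⊆B-trans s s′) y D ⊆B-refl K′ p (everyExtension-mono x s′))
  !-elim {L = L} {K = K} φ (a ⊕ b) h k = λ C s K′ p x y →
    supp-reassoc (atom p) L K K′ (h C s (K ++ K′) p λ D s′ z →
      k D (⊆B-trans s s′) z D ⊆B-refl K′ p (everyExtension-mono x s′) (everyExtension-mono y s′))
  !-elim {L = L} {K = K} φ (! ψ) h k = λ C s K′ p x →
    supp-reassoc (atom p) L K K′ (h C s (K ++ K′) p λ D s′ y →
      k D (⊆B-trans s s′) y D ⊆B-refl K′ p (everyExtension-mono x s′))

  antecedent⇒suppMS : Pointwise EntryOf Γ es → Bangs es C → MS (Lins es) C K → suppMS C K Γ
  antecedent⇒suppMS [] _ m = m
  antecedent⇒suppMS {Γ = _ ∷ Γ} (bangEntry δ ∷ v) (x , bs) m =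
    MS-cons⁺ (supportOf (! δ)) (map supportOf Γ) (supp-resp-↭ (! δ)) ↭-refl
      (!-intro δ x) (antecedent⇒suppMS v bs m)
  antecedent⇒suppMS {Γ = _ ∷ Γ} {es = _ ∷ es} (linEntry γ ∷ v) bs m
    with MS-cons⁻ (supportOf γ) (Lins es) m
  ... | K₁ , K₂ , σ , x , m′ =
    MS-cons⁺ (supportOf γ) (map supportOf Γ) (supp-resp-↭ γ) σ x (antecedent⇒suppMS v bs m′)

  InfG-cut : ∀ χ → Pointwise EntryOf Γ es
    → InfG es (supportOf χ) C M → suppMS C K Γ → supp C (M ++ K) χ
  InfG-cut χ [] h m = h _ ⊆B-refl _ (lift tt) m
  InfG-cut {Γ = _ ∷ Γ} {M = M} χ (bangEntry δ ∷ v) h m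
    with MS-cons⁻ (supportOf (! δ)) (map supportOf Γ) m
  ... | K₁ , K₂ , σ , x , m′ =
    supp-resp-↭ χ (↭-trans (shifts K₁ M) (++⁺ˡ M (↭-sym σ))) (!-elim δ χ x λ D C⊆D y →
      InfG-cut χ v (λ E D⊆E K′ bs ms → h E (⊆B-trans C⊆D D⊆E) K′ (supp-mono δ y D⊆E , bs) ms)
        (suppMS-mono Γ m′ C⊆D))
  InfG-cut {Γ = _ ∷ Γ} {es = _ ∷ es} {C = C} {M = M} χ (linEntry γ ∷ v) h m
    with MS-cons⁻ (supportOf γ) (map supportOf Γ) m
  ... | K₁ , K₂ , σ , x , m′ =
    supp-resp-↭ χ (↭-trans (++-assoc M K₁ K₂) (++⁺ˡ M (↭-sym σ))) (InfG-cut χ v h′ m′)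
    where
    h′ : InfG es (supportOf χ) C (M ++ K₁)
    h′ D C⊆D K′ bs ms = supp-resp-↭ χ (↭-sym (++-assoc M K₁ K′)) (h D C⊆D (K₁ ++ K′) bs
      (MS-cons⁺ (supportOf γ) (Lins es) (supp-resp-↭ γ) ↭-refl (supp-mono γ x C⊆D) ms))

mainTheorem18 : {Atom : Set} (B : Base {Atom}) (L : List Atom)
                  (Γ : List (Formula Atom)) (φ : Formula Atom)
                → (Γ ⊩[ B , L ] φ)
                  ⇔ (∀ C → B ⊆B C → ∀ K → suppMS C K Γ → supp C (L ++ K) φ)
mainTheorem18 B L [] φ = mk⇔
  (λ x C B⊆C K (lift K↭[]) →
    supp-resp-↭ φ (↭-trans (↭-sym (++-identityʳ L)) (++⁺ˡ L (↭-sym K↭[]))) (supp-mono φ x B⊆C))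
  (λ h → supp-resp-↭ φ (++-identityʳ L) (h B ⊆B-refl [] (lift ↭-refl)))
mainTheorem18 B L Γ@(_ ∷ _) φ = mk⇔
  (λ h C B⊆C K m → InfG-cut φ (entries Γ) (everyExtension-mono h B⊆C) m)
  (λ h C B⊆C K bs m → h C B⊆C K (antecedent⇒suppMS (entries Γ) bs m))
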